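{- For all integers $m,n\ge 3$, $\chi_i(C_m\Box C_n)\ge 5$. Moreover, $\chi_i(C_m\Box C_n)=5$ if and only if $m\equiv 0\pmod 5$ and $n\equiv 0 \pmod 5$.
   Context: For a graph $G$, an incidence is a pair $(v,e)$ with $v\in V(G)$, $e\in E(G)$ and $v$ incident with $e$. Two incidences $(v,e)$ and $(w,f)$ are adjacent if $v=w$, or $e=f$, or the edge $vw$ equals $e$ or $f$. An incidence $k$-coloring of $G$ is a map from the set of incidences of $G$ to a set of $k$ colors such that adjacent incidences receive distinct colors; $\chi_i(G)$ is the least $k$ for which such a coloring exists. $C_n$ is the cycle on $n$ vertices and $\Box$ denotes the Cartesian product of graphs: $(u_1,v_1)\sim(u_2,v_2)$ iff ($u_1=u_2$ and $v_1v_2$ an edge) or ($v_1=v_2$ and $u_1u_2$ an edge). -}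

module Defs where

open import Data.Nat using (ℕ; zero; suc; _≤_)
open import Data.Fin using (Fin; toℕ)
open import Data.Product using (Σ; _×_; _,_; ∃)
open import Data.Sum using (_⊎_)
open import Relation.Binary.PropositionalEquality using (_≡_; _≢_)
open import Relation.Nullary using (¬_)

-- A graph: a vertex type with an adjacency relation (assumed symmetric,
-- irreflexive for the graphs we build).
record Graph : Set₁ where
  field
    V    : Set
    Adj  : V → V → Set
open Graph public

CycAdj : (m : ℕ) → Fin m → Fin m → Set
CycAdj m i j =
    (suc (toℕ i) ≡ toℕ j)
  ⊎ (suc (toℕ j) ≡ toℕ i)
  ⊎ (toℕ i ≡ 0 × suc (toℕ j) ≡ m)
  ⊎ (toℕ j ≡ 0 × suc (toℕ i) ≡ m)

Cycle : ℕ → Graph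
Cycle m = record { V = Fin m ; Adj = CycAdj m }

_□_ : Graph → Graph → Graph
G □ H = record
  { V   = V G × V H
  ; Adj = λ { (u₁ , v₁) (u₂ , v₂) →
              (u₁ ≡ u₂ × Adj H v₁ v₂) ⊎ (v₁ ≡ v₂ × Adj G u₁ u₂) } }

-- An edge is given by its two endpoints; edges {x,y} and {x',y'} are equal
-- iff the unordered pairs coincide.
SameEdge : {A : Set} → A × A → A × A → Set
SameEdge (x , y) (x' , y') = (x ≡ x' × y ≡ y') ⊎ (x ≡ y' × y ≡ x')

-- An incidence (v, e) with e = vw is represented by (v, w, proof v ~ w).
Incidence : Graph → Set
Incidence G = Σ (V G) λ v → Σ (V G) λ w → Adj G v w

ivert : {G : Graph} → Incidence G → V G
ivert (v , _ , _) = v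

iedge : {G : Graph} → Incidence G → V G × V G
iedge (v , w , _) = (v , w)

SameIncidence : {G : Graph} → Incidence G → Incidence G → Set
SameIncidence ι κ = ivert ι ≡ ivert κ × SameEdge (iedge ι) (iedge κ)

IncAdj : {G : Graph} → Incidence G → Incidence G → Set
IncAdj ι κ =
    ivert ι ≡ ivert κ
  ⊎ SameEdge (iedge ι) (iedge κ)
  ⊎ SameEdge (ivert ι , ivert κ) (iedge ι)
  ⊎ SameEdge (ivert ι , ivert κ) (iedge κ)

IsIncidenceColoring : (G : Graph) (k : ℕ) → (Incidence G → Fin k) → Set
IsIncidenceColoring G k c =
  (ι κ : Incidence G) → ¬ SameIncidence {G} ι κ → IncAdj {G} ι κ → c ι ≢ c κ

IncColorable : Graph → ℕ → Set
IncColorable G k = ∃ λ (c : Incidence G → Fin k) → IsIncidenceColoring G k c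

IncChromaticNumber : Graph → ℕ → Set
IncChromaticNumber G k = IncColorable G k × ((j : ℕ) → IncColorable G j → k ≤ j)

-- Every vertex q of the torus C_m □ C_n has four distinct neighbours, and its four outgoing
-- incidences together with any incoming one are pairwise adjacent; hence χ_i ≥ 5.  In an incidence
-- 5-colouring all incidences entering q must take the single colour missing at the outgoing ones,
-- and this colour a(q) of the vertex q is injective on every closed neighbourhood.  Such a grid
-- colouring gives distinct colours to any five consecutive vertices of a row, so along every row it
-- has minimal period 5, and as the row closes up after m steps, 5 ∣ m; likewise 5 ∣ n.  Conversely,
-- if 5 ∣ m and 5 ∣ n, colouring each incidence (v, (x, y)) by x + 2y mod 5 works, because every
-- closed neighbourhood receives five consecutive values of x + 2y.
module Submission where

open import Defs
open import Data.Nat using (ℕ; zero; suc; pred; _+_; _*_; _∸_; _≤_; _<_; s≤s; s≤s⁻¹; z≤n; NonZero; _%_; _<?_)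
open import Data.Nat.Properties
  using (1+n≰n; 1+n≢n; m≢1+n+m; <⇒≢; ≮⇒≥; ≤-antisym; ≤-trans; ≤-reflexive; ≤-<-trans; <-cmp;
         n<1+n; n≤0⇒n≡0; m≤n⇒m<n∨m≡n; m≤n⇒∃[o]m+o≡n; m≤n+m; suc-injective; suc-pred;
         +-identityʳ; +-assoc; +-comm; +-suc; +-monoˡ-<; +-cancelʳ-≤; ∸-monoˡ-<; m+n∸m≡n;
         module ≤-Reasoning)
open import Data.Nat.DivMod
  using (_mod_; _/_; m%n<n; m%n≤m; m<n⇒m%n≡m; n%n≡0; m≡m%n+[m/n]*n; %-distribˡ-+; [m+kn]%n≡m%n;
         [m+n]%n≡m%n; m≤n⇒[n∸m]%m≡n%m; m∣n⇒o%n%m≡o%m)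
open import Data.Nat.Divisibility using (_∣_; m%n≡0⇒n∣m)
open import Data.Nat.Tactic.RingSolver using (solve-∀)
open import Data.Fin using (Fin; zero; suc; toℕ; #_; _≟_)
open import Data.Fin.Properties using (injective⇒≤; pigeonhole; toℕ<n; toℕ-injective; toℕ-fromℕ<)
open import Data.Vec using (Vec; []; _∷_; lookup)
open import Data.Vec.Relation.Unary.All using (All; []; _∷_)
open import Data.Vec.Relation.Unary.Any using (here; there; any?)
open import Data.Vec.Membership.Propositional using (_∈_)
open import Data.Vec.Relation.Unary.Unique.Propositional using (Unique; []; _∷_)
open import Data.Vec.Relation.Unary.Unique.Propositional.Properties using (lookup-injective)
open import Data.Product using (Σ; _×_; _,_; proj₁; proj₂)
open import Data.Sum using (_⊎_; inj₁; inj₂; [_,_])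
open import Data.Empty using (⊥-elim)
open import Function using (_∘_; Injective)
open import Function.Bundles using (_⇔_; mk⇔)
open import Relation.Nullary using (¬_; yes; no; contradiction)
open import Relation.Nullary.Decidable using (False; toWitnessFalse)
open import Relation.Binary.Definitions using (tri<; tri≈; tri>)
open import Relation.Binary.PropositionalEquality
  using (_≡_; _≢_; refl; sym; trans; cong; cong₂; subst; module ≡-Reasoning)

-- Pigeonhole principles for duplicate-free vectors over Fin

¬∈⇒All≢ : ∀ {A : Set} {n} {y : A} {xs : Vec A n} → ¬ y ∈ xs → All (y ≢_) xs
¬∈⇒All≢ {xs = []}     _   = []
¬∈⇒All≢ {xs = x ∷ xs} y∉ = (y∉ ∘ here) ∷ ¬∈⇒All≢ (y∉ ∘ there)

unique⇒length≤ : ∀ {k n} {xs : Vec (Fin k) n} → Unique xs → n ≤ k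
unique⇒length≤ u = injective⇒≤ (lookup-injective u _ _)

unique⇒∈ : ∀ {n} {xs : Vec (Fin n) n} → Unique xs → ∀ y → y ∈ xs
unique⇒∈ {xs = xs} u y with any? (y ≟_) xs
... | yes y∈xs = y∈xs
... | no  y∉xs = contradiction (unique⇒length≤ (¬∈⇒All≢ y∉xs ∷ u)) 1+n≰n

unique-avoiders-≡ : ∀ {n x y} {xs : Vec (Fin (suc n)) n} →
  Unique xs → All (x ≢_) xs → All (y ≢_) xs → x ≡ y
unique-avoiders-≡ {x = x} {y} u x∉ y∉ with x ≟ y
... | yes x≡y = x≡y
... | no  x≢y = contradiction (unique⇒length≤ ((x≢y ∷ x∉) ∷ y∉ ∷ u)) 1+n≰n

-- Residues

1+m+o≡n⇒n+k≡1+o+[m+k] : ∀ m o {n k} → suc m + o ≡ n → n + k ≡ suc o + (m + k)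
1+m+o≡n⇒n+k≡1+o+[m+k] m o {k = k} refl = rearrange m o k
  where
  rearrange : ∀ a b c → suc a + b + c ≡ suc b + (a + c)
  rearrange = solve-∀

m+[1+n]+[1+n]≡2+[m+n+n] : ∀ m n → m + suc n + suc n ≡ 2 + (m + n + n)
m+[1+n]+[1+n]≡2+[m+n+n] m n = trans (+-suc (m + suc n) n) (cong suc (cong (_+ n) (+-suc m n)))

[1+d+m]%n≢m%n : ∀ d m n .{{_ : NonZero n}} → suc d < n → (suc d + m) % n ≢ m % n
[1+d+m]%n≢m%n d m n 1+d<n eq = [1+d+r]%n≢r (trans (sym reduce) eq)
  where
  r = m % n
  reduce : (suc d + m) % n ≡ (suc d + r) % n
  reduce = trans (%-distribˡ-+ (suc d) m n) (cong (λ z → (z + r) % n) (m<n⇒m%n≡m 1+d<n))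
  [1+d+r]%n≢r : (suc d + r) % n ≢ r
  [1+d+r]%n≢r with suc d + r <? n
  ... | yes small = λ e → m≢1+n+m r (sym (trans (sym (m<n⇒m%n≡m small)) e))
  ... | no  large = <⇒≢ (begin-strict
      (suc d + r) % n      ≡⟨ sym (m≤n⇒[n∸m]%m≡n%m n≤) ⟩
      (suc d + r ∸ n) % n  ≤⟨ m%n≤m _ n ⟩
      suc d + r ∸ n        <⟨ ∸-monoˡ-< (+-monoˡ-< r 1+d<n) n≤ ⟩
      n + r ∸ n            ≡⟨ m+n∸m≡n n r ⟩
      r                    ∎)
    where
    open ≤-Reasoning
    n≤ : n ≤ suc d + r
    n≤ = ≮⇒≥ large

%-cong-+ : ∀ a a′ b b′ {d} .{{_ : NonZero d}} →
  a % d ≡ a′ % d → b % d ≡ b′ % d → (a + b) % d ≡ (a′ + b′) % d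
%-cong-+ a a′ b b′ {d} ea eb =
  trans (%-distribˡ-+ a b d) (trans (cong₂ (λ s t → (s + t) % d) ea eb) (sym (%-distribˡ-+ a′ b′ d)))

DistinctWithin : (n : ℕ) → (ℕ → Fin n) → Set
DistinctWithin n s = ∀ i d → suc d < n → s i ≢ s (suc d + i)

-- Two of the n + 1 values s i, …, s (n + i) coincide, and only the outermost two may.
distinctWithin⇒periodic : ∀ {n s} → DistinctWithin n s → ∀ i → s (n + i) ≡ s i
distinctWithin⇒periodic {n} {s} distinct i
  with k , k′ , k<k′ , sk≡sk′ ← pigeonhole (n<1+n n) (λ k → s (toℕ k + i))
  with o , 1+k+o≡k′ ← m≤n⇒∃[o]m+o≡n k<k′
  with suc o <? n
... | yes 1+o<n = contradiction (trans sk≡sk′ (cong s (1+m+o≡n⇒n+k≡1+o+[m+k] (toℕ k) o 1+k+o≡k′)))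
                                (distinct (toℕ k + i) o 1+o<n)
... | no  1+o≮n =
  trans (cong (λ j → s (j + i)) (sym k′≡n)) (trans (sym sk≡sk′) (cong (λ j → s (j + i)) k≡0))
  where
  k′≡n : toℕ k′ ≡ n
  k′≡n = ≤-antisym (s≤s⁻¹ (toℕ<n k′))
    (≤-trans (≮⇒≥ 1+o≮n) (≤-trans (s≤s (m≤n+m o (toℕ k))) (≤-reflexive 1+k+o≡k′)))
  k≡0 : toℕ k ≡ 0
  k≡0 = n≤0⇒n≡0 (+-cancelʳ-≤ o (toℕ k) 0
    (s≤s⁻¹ (≤-trans (≤-reflexive (trans 1+k+o≡k′ k′≡n)) (≮⇒≥ 1+o≮n))))

distinctWithin∧period⇒∣ : ∀ {n s} P .{{_ : NonZero n}} →
  DistinctWithin n s → (∀ i → s (i + P) ≡ s i) → n ∣ P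
distinctWithin∧period⇒∣ {n} {s} P distinct period =
  m%n≡0⇒n∣m P n (residue≡0 (P % n) (m%n<n P n) (trans (sym (period 0)) s[P]≡s[P%n]))
  where
  periodic : ∀ q i → s (q * n + i) ≡ s i
  periodic zero    i = refl
  periodic (suc q) i = trans (cong s (+-assoc n (q * n) i))
                             (trans (distinctWithin⇒periodic distinct (q * n + i)) (periodic q i))
  s[P]≡s[P%n] : s P ≡ s (P % n)
  s[P]≡s[P%n] = trans (cong s (trans (m≡m%n+[m/n]*n P n) (+-comm (P % n) _))) (periodic (P / n) (P % n))
  residue≡0 : ∀ r → r < n → s 0 ≡ s r → r ≡ 0
  residue≡0 zero    _     _  = refl
  residue≡0 (suc d) 1+d<n eq = contradiction (trans eq (cong s (sym (+-identityʳ (suc d))))) (distinct 0 d 1+d<n)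

-- Grid colourings that are injective on closed neighbourhoods

-- The closed neighbourhood of (1 + x, 1 + y), in the order centre, west, east, south, north.
star : ∀ {A : Set} → (ℕ → ℕ → A) → ℕ → ℕ → Vec A 5
star a x y = a (suc x) (suc y) ∷ a x (suc y) ∷ a (2 + x) (suc y) ∷ a (suc x) y ∷ a (suc x) (2 + y) ∷ []

Rainbow : ∀ {A : Set} → (ℕ → ℕ → A) → Set
Rainbow a = ∀ x y → Unique (star a x y)

rainbow-apart : ∀ {A : Set} {a : ℕ → ℕ → A} → Rainbow a → ∀ x y i j {_ : False (i ≟ j)} →
  lookup (star a x y) i ≢ lookup (star a x y) j
rainbow-apart R x y i j {i≢j} = toWitnessFalse i≢j ∘ lookup-injective (R x y) i j

rainbow-transpose : ∀ {A : Set} {a : ℕ → ℕ → A} → Rainbow a → Rainbow (λ x y → a y x)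
rainbow-transpose {a = a} R x y =
  (apart (# 0) (# 3) ∷ apart (# 0) (# 4) ∷ apart (# 0) (# 1) ∷ apart (# 0) (# 2) ∷ []) ∷
  (apart (# 3) (# 4) ∷ apart (# 3) (# 1) ∷ apart (# 3) (# 2) ∷ []) ∷
  (apart (# 4) (# 1) ∷ apart (# 4) (# 2) ∷ []) ∷
  (apart (# 1) (# 2) ∷ []) ∷ [] ∷ []
  where
  apart : ∀ i j {_ : False (i ≟ j)} → lookup (star a y x) i ≢ lookup (star a y x) j
  apart = rainbow-apart {a = a} R y x

module RainbowRows {a : ℕ → ℕ → Fin 5} (R : Rainbow a) where

  ≢-east : ∀ {x y} → a x (suc y) ≢ a (suc x) (suc y)
  ≢-east = rainbow-apart {a = a} R _ _ (# 1) (# 0)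

  ≢-east² : ∀ {x y} → a x (suc y) ≢ a (2 + x) (suc y)
  ≢-east² = rainbow-apart {a = a} R _ _ (# 1) (# 2)

  ≢-north : ∀ {x y} → a (suc x) y ≢ a (suc x) (suc y)
  ≢-north = rainbow-apart {a = a} R _ _ (# 3) (# 0)

  ≢-north² : ∀ {x y} → a (suc x) y ≢ a (suc x) (2 + y)
  ≢-north² = rainbow-apart {a = a} R _ _ (# 3) (# 4)

  ≢-northeast : ∀ {x y} → a x (suc y) ≢ a (suc x) (2 + y)
  ≢-northeast = rainbow-apart {a = a} R _ _ (# 1) (# 4)

  ≢-southeast : ∀ {x y} → a x (suc y) ≢ a (suc x) y
  ≢-southeast = rainbow-apart {a = a} R _ _ (# 1) (# 3)

  colour-in-star : ∀ x y c → c ∈ star a x y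
  colour-in-star x y = unique⇒∈ (R x y)

  -- The colour of a cell occurs in the star diagonally next to it, but not on the three cells of
  -- that star within distance 2 of the cell; so it recurs a knight's move away.

  knight-up-right : ∀ x y → a (2 + x) (5 + y) ≡ a (1 + x) (3 + y) ⊎ a (3 + x) (4 + y) ≡ a (1 + x) (3 + y)
  knight-up-right x y with colour-in-star (1 + x) (3 + y) (a (1 + x) (3 + y))
  ... | here e                                 = ⊥-elim (≢-northeast e)
  ... | there (here e)                         = ⊥-elim (≢-north e)
  ... | there (there (here e))                 = inj₂ (sym e)
  ... | there (there (there (here e)))         = ⊥-elim (≢-east e)
  ... | there (there (there (there (here e)))) = inj₁ (sym e)

  knight-down-right : ∀ x y → a (2 + x) (1 + y) ≡ a (1 + x) (3 + y) ⊎ a (3 + x) (2 + y) ≡ a (1 + x) (3 + y)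
  knight-down-right x y with colour-in-star (1 + x) (1 + y) (a (1 + x) (3 + y))
  ... | here e                                 = ⊥-elim (≢-southeast e)
  ... | there (here e)                         = ⊥-elim (≢-north (sym e))
  ... | there (there (here e))                 = inj₂ (sym e)
  ... | there (there (there (here e)))         = inj₁ (sym e)
  ... | there (there (there (there (here e)))) = ⊥-elim (≢-east e)

  knight-up-left : ∀ x y → a (2 + x) (5 + y) ≡ a (3 + x) (3 + y) ⊎ a (1 + x) (4 + y) ≡ a (3 + x) (3 + y)
  knight-up-left x y with colour-in-star (1 + x) (3 + y) (a (3 + x) (3 + y))
  ... | here e                                 = ⊥-elim (≢-southeast (sym e))
  ... | there (here e)                         = inj₂ (sym e)
  ... | there (there (here e))                 = ⊥-elim (≢-north e)
  ... | there (there (there (here e)))         = ⊥-elim (≢-east (sym e))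
  ... | there (there (there (there (here e)))) = inj₁ (sym e)

  knight-down-left : ∀ x y → a (2 + x) (1 + y) ≡ a (3 + x) (3 + y) ⊎ a (1 + x) (2 + y) ≡ a (3 + x) (3 + y)
  knight-down-left x y with colour-in-star (1 + x) (1 + y) (a (3 + x) (3 + y))
  ... | here e                                 = ⊥-elim (≢-northeast (sym e))
  ... | there (here e)                         = inj₂ (sym e)
  ... | there (there (here e))                 = ⊥-elim (≢-north (sym e))
  ... | there (there (there (here e)))         = inj₁ (sym e)
  ... | there (there (there (there (here e)))) = ⊥-elim (≢-east (sym e))

  ≢-east³ : ∀ x y → a (1 + x) (3 + y) ≢ a (4 + x) (3 + y)
  ≢-east³ x y same with knight-up-right x y | knight-up-left (1 + x) y
  ... | inj₂ e | _       = ≢-southeast (trans e same)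
  ... | _      | inj₂ e  = ≢-northeast (trans same (sym e))
  ... | inj₁ e | inj₁ e′ = ≢-east (trans e (trans same (sym e′)))

  ≢-east⁴ : ∀ x y → a (1 + x) (3 + y) ≢ a (5 + x) (3 + y)
  ≢-east⁴ x y same
    with knight-up-right x y | knight-up-left (2 + x) y | knight-down-right x y | knight-down-left (2 + x) y
  ... | inj₁ u | inj₁ u′ | _      | _       = ≢-east² (trans u (trans same (sym u′)))
  ... | _      | _       | inj₁ d | inj₁ d′ = ≢-east² (trans d (trans same (sym d′)))
  ... | inj₂ u | _       | inj₂ d | _       = ≢-north² (trans d (sym u))
  ... | inj₂ u | _       | _      | inj₂ d′ = ≢-north² (trans d′ (trans (sym same) (sym u)))
  ... | _      | inj₂ u′ | inj₂ d | _       = ≢-north² (trans d (trans same (sym u′)))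
  ... | _      | inj₂ u′ | _      | inj₂ d′ = ≢-north² (trans d′ (sym u′))

  row-distinctWithin : ∀ y → DistinctWithin 5 (λ x → a (suc x) (3 + y))
  row-distinctWithin y i 0 _ = ≢-east
  row-distinctWithin y i 1 _ = ≢-east²
  row-distinctWithin y i 2 _ = ≢-east³ i y
  row-distinctWithin y i 3 _ = ≢-east⁴ i y
  row-distinctWithin y i (suc (suc (suc (suc d)))) (s≤s (s≤s (s≤s (s≤s (s≤s ())))))

rainbow-row-period⇒5∣ : ∀ {a : ℕ → ℕ → Fin 5} P →
  Rainbow a → (∀ x y → a (x + P) y ≡ a x y) → 5 ∣ P
rainbow-row-period⇒5∣ {a} P R period =
  distinctWithin∧period⇒∣ P (RainbowRows.row-distinctWithin {a} R 0) (λ i → period (suc i) 3)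

-- Incidence colourings of arbitrary graphs

module IncidenceColouring {G : Graph} {k : ℕ} {c : Incidence G → Fin k} (valid : IsIncidenceColoring G k c) where

  out≢out : ∀ {q w w′} (p : Adj G q w) (p′ : Adj G q w′) → w ≢ w′ → c (q , w , p) ≢ c (q , w′ , p′)
  out≢out {q} {w} {w′} p p′ w≢w′ = valid _ _ distinct (inj₁ refl)
    where
    distinct : ¬ SameIncidence {G} (q , w , p) (q , w′ , p′)
    distinct (_ , inj₁ (_ , w≡w′))    = w≢w′ w≡w′
    distinct (_ , inj₂ (q≡w′ , w≡q)) = w≢w′ (trans w≡q q≡w′)

  in≢out : ∀ {q w w′} (p : Adj G w q) (p′ : Adj G q w′) → w ≢ q → c (w , q , p) ≢ c (q , w′ , p′)
  in≢out p p′ w≢q = valid _ _ (w≢q ∘ proj₁) (inj₂ (inj₂ (inj₁ (inj₁ (refl , refl)))))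

  outColours : ∀ {q d} {ns : Vec (V G) d} → All (Adj G q) ns → Vec (Fin k) d
  outColours []       = []
  outColours (p ∷ ps) = c (_ , _ , p) ∷ outColours ps

  out-avoids-outColours : ∀ {q w d} {ns : Vec (V G) d} (p : Adj G q w) →
    All (w ≢_) ns → (ps : All (Adj G q) ns) → All (c (q , w , p) ≢_) (outColours ps)
  out-avoids-outColours p []            []        = []
  out-avoids-outColours p (w≢n ∷ w≢ns) (p′ ∷ ps) = out≢out p p′ w≢n ∷ out-avoids-outColours p w≢ns ps

  in-avoids-outColours : ∀ {q w d} {ns : Vec (V G) d} (p : Adj G w q) → w ≢ q →
    (ps : All (Adj G q) ns) → All (c (w , q , p) ≢_) (outColours ps)
  in-avoids-outColours p w≢q []        = []
  in-avoids-outColours p w≢q (p′ ∷ ps) = in≢out p p′ w≢q ∷ in-avoids-outColours p w≢q ps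

  outColours-unique : ∀ {q d} {ns : Vec (V G) d} → Unique ns → (ps : All (Adj G q) ns) → Unique (outColours ps)
  outColours-unique []           []       = []
  outColours-unique (n∉ns ∷ uns) (p ∷ ps) = out-avoids-outColours p n∉ns ps ∷ outColours-unique uns ps

  in∷outColours-unique : ∀ {q w d} {ns : Vec (V G) d} → Unique ns → (ps : All (Adj G q) ns) →
    (p : Adj G w q) → w ≢ q → Unique (c (w , q , p) ∷ outColours ps)
  in∷outColours-unique uns ps p w≢q = in-avoids-outColours p w≢q ps ∷ outColours-unique uns ps

  degree<colours : ∀ {q w d} {ns : Vec (V G) d} → Unique ns → All (Adj G q) ns → Adj G w q → w ≢ q → d < k
  degree<colours uns ps p w≢q = unique⇒length≤ (in∷outColours-unique uns ps p w≢q)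

in-colours-agree : ∀ {G d} {c : Incidence G → Fin (suc d)} → IsIncidenceColoring G (suc d) c →
  ∀ {q w w′} {ns : Vec (V G) d} → Unique ns → All (Adj G q) ns →
  (p : Adj G w q) (p′ : Adj G w′ q) → w ≢ q → w′ ≢ q → c (w , q , p) ≡ c (w′ , q , p′)
in-colours-agree valid uns ps p p′ w≢q w′≢q =
  unique-avoiders-≡ (outColours-unique uns ps) (in-avoids-outColours p w≢q ps) (in-avoids-outColours p′ w′≢q ps)
  where open IncidenceColouring valid

module _ {G k} (χ : V G → Fin k) (irrefl : ∀ {v} → ¬ Adj G v v)
  (adjacent-distinct : ∀ {v w} → Adj G v w → χ v ≢ χ w)
  (neighbours-injective : ∀ {v w w′} → Adj G v w → Adj G v w′ → χ w ≡ χ w′ → w ≡ w′) where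

  head-colouring : IsIncidenceColoring G k (λ (_ , w , _) → χ w)
  head-colouring (v , w , p) (v′ , w′ , p′) different (inj₁ refl) e =
    different (refl , inj₁ (refl , neighbours-injective p p′ e))
  head-colouring _ _ different (inj₂ (inj₁ same@(inj₁ (v≡v′ , _)))) _      = different (v≡v′ , same)
  head-colouring _ (_ , _ , p′) _ (inj₂ (inj₁ (inj₂ (refl , refl)))) e     = adjacent-distinct p′ e
  head-colouring _ (_ , _ , p′) _ (inj₂ (inj₂ (inj₁ (inj₁ (_ , refl))))) e = adjacent-distinct p′ e
  head-colouring (_ , _ , p) _ _ (inj₂ (inj₂ (inj₁ (inj₂ (refl , _))))) _  = irrefl p
  head-colouring _ (_ , _ , p′) _ (inj₂ (inj₂ (inj₂ (inj₁ (_ , refl))))) _ = irrefl p′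
  head-colouring (_ , _ , p) _ _ (inj₂ (inj₂ (inj₂ (inj₂ (refl , _))))) e  = adjacent-distinct p (sym e)

-- Cycles

Succ : (m : ℕ) → Fin m → Fin m → Set
Succ m i j = suc (toℕ i) ≡ toℕ j ⊎ (toℕ j ≡ 0 × suc (toℕ i) ≡ m)

module _ {m : ℕ} where

  Succ⇒CycAdj : ∀ {i j} → Succ m i j → CycAdj m i j
  Succ⇒CycAdj (inj₁ e) = inj₁ e
  Succ⇒CycAdj (inj₂ e) = inj₂ (inj₂ (inj₂ e))

  Succ⇒CycAdj⁻¹ : ∀ {i j} → Succ m j i → CycAdj m i j
  Succ⇒CycAdj⁻¹ (inj₁ e) = inj₂ (inj₁ e)
  Succ⇒CycAdj⁻¹ (inj₂ e) = inj₂ (inj₂ (inj₁ e))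

  CycAdj⇒Succ : ∀ {i j} → CycAdj m i j → Succ m i j ⊎ Succ m j i
  CycAdj⇒Succ (inj₁ e)               = inj₁ (inj₁ e)
  CycAdj⇒Succ (inj₂ (inj₁ e))        = inj₂ (inj₁ e)
  CycAdj⇒Succ (inj₂ (inj₂ (inj₁ e))) = inj₂ (inj₂ e)
  CycAdj⇒Succ (inj₂ (inj₂ (inj₂ e))) = inj₁ (inj₂ e)

  CycAdj-sym : ∀ {i j} → CycAdj m i j → CycAdj m j i
  CycAdj-sym = [ Succ⇒CycAdj⁻¹ , Succ⇒CycAdj ] ∘ CycAdj⇒Succ

  Succ-functional : ∀ {i j j′} → Succ m i j → Succ m i j′ → j ≡ j′
  Succ-functional           (inj₁ e)       (inj₁ e′)       = toℕ-injective (trans (sym e) e′)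
  Succ-functional {j = j}   (inj₁ e)       (inj₂ (_ , e′)) = contradiction (trans (sym e) e′) (<⇒≢ (toℕ<n j))
  Succ-functional {j′ = j′} (inj₂ (_ , e)) (inj₁ e′)       = contradiction (trans (sym e′) e) (<⇒≢ (toℕ<n j′))
  Succ-functional           (inj₂ (e , _)) (inj₂ (e′ , _)) = toℕ-injective (trans e (sym e′))

  Succ-injective : ∀ {i i′ j} → Succ m i j → Succ m i′ j → i ≡ i′
  Succ-injective (inj₁ e)       (inj₁ e′)       = toℕ-injective (suc-injective (trans e (sym e′)))
  Succ-injective (inj₁ e)       (inj₂ (e′ , _)) = contradiction (trans e e′) λ ()
  Succ-injective (inj₂ (e , _)) (inj₁ e′)       = contradiction (trans e′ e) λ ()
  Succ-injective (inj₂ (_ , e)) (inj₂ (_ , e′)) = toℕ-injective (suc-injective (trans e (sym e′)))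

  Succ-irrefl : 1 < m → ∀ {i} → ¬ Succ m i i
  Succ-irrefl _   (inj₁ e)        = 1+n≢n e
  Succ-irrefl 1<m (inj₂ (e , e′)) = <⇒≢ 1<m (trans (cong suc (sym e)) e′)

  CycAdj-irrefl : 1 < m → ∀ {i} → ¬ CycAdj m i i
  CycAdj-irrefl 1<m = [ Succ-irrefl 1<m , Succ-irrefl 1<m ] ∘ CycAdj⇒Succ

module _ (m : ℕ) .{{_ : NonZero m}} where

  toℕ-mod : ∀ x → toℕ (x mod m) ≡ x % m
  toℕ-mod x = toℕ-fromℕ< (m%n<n x m)

  [1+x]%m≡[1+x%m]%m : ∀ x → suc x % m ≡ suc (x % m) % m
  [1+x]%m≡[1+x%m]%m x =
    trans (cong (λ z → suc z % m) (m≡m%n+[m/n]*n x m)) ([m+kn]%n≡m%n (suc (x % m)) (x / m) m)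

  Succ-mod : ∀ x → Succ m (x mod m) (suc x mod m)
  Succ-mod x rewrite toℕ-mod x | toℕ-mod (suc x) | [1+x]%m≡[1+x%m]%m x with m≤n⇒m<n∨m≡n (m%n<n x m)
  ... | inj₁ 1+r<m = inj₁ (sym (m<n⇒m%n≡m 1+r<m))
  ... | inj₂ 1+r≡m = inj₂ (trans (cong (_% m) 1+r≡m) (n%n≡0 m) , 1+r≡m)

  CycAdj-mod : ∀ x → CycAdj m (x mod m) (suc x mod m)
  CycAdj-mod x = Succ⇒CycAdj (Succ-mod x)

  CycAdj-mod-neighbours : ∀ x {j} → CycAdj m (suc x mod m) j → j ≡ x mod m ⊎ j ≡ (2 + x) mod m
  CycAdj-mod-neighbours x adj with CycAdj⇒Succ adj
  ... | inj₁ s = inj₂ (Succ-functional s (Succ-mod (suc x)))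
  ... | inj₂ s = inj₁ (Succ-injective s (Succ-mod x))

  mod-period : ∀ x → (x + m) mod m ≡ x mod m
  mod-period x = toℕ-injective (trans (toℕ-mod (x + m)) (trans ([m+n]%n≡m%n x m) (sym (toℕ-mod x))))

  mod-distinct : ∀ x d → suc d < m → x mod m ≢ (suc d + x) mod m
  mod-distinct x d 1+d<m e =
    [1+d+m]%n≢m%n d x m 1+d<m (trans (sym (toℕ-mod (suc d + x))) (trans (cong toℕ (sym e)) (toℕ-mod x)))

  toℕ-mod-id : ∀ (i : Fin m) → toℕ i mod m ≡ i
  toℕ-mod-id i = toℕ-injective (trans (toℕ-mod (toℕ i)) (m<n⇒m%n≡m (toℕ<n i)))

  suc-mod-surjective : ∀ (i : Fin m) → Σ ℕ λ x → suc x mod m ≡ i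
  suc-mod-surjective i = toℕ i + pred m , (begin
    suc (toℕ i + pred m) mod m   ≡⟨ cong (_mod m) (sym (+-suc (toℕ i) (pred m))) ⟩
    (toℕ i + suc (pred m)) mod m ≡⟨ cong (λ t → (toℕ i + t) mod m) (suc-pred m) ⟩
    (toℕ i + m) mod m            ≡⟨ mod-period (toℕ i) ⟩
    toℕ i mod m                  ≡⟨ toℕ-mod-id i ⟩
    i                            ∎)
    where open ≡-Reasoning

  mod-window-distinct : ∀ z {i j : Fin m} → toℕ i < toℕ j → (toℕ i + z) mod m ≢ (toℕ j + z) mod m
  mod-window-distinct z {i} {j} i<j with o , 1+i+o≡j ← m≤n⇒∃[o]m+o≡n i<j =
    subst (λ t → (toℕ i + z) mod m ≢ t mod m) (sym (1+m+o≡n⇒n+k≡1+o+[m+k] (toℕ i) o 1+i+o≡j))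
      (mod-distinct (toℕ i + z) o 1+o<m)
    where
    1+o<m : suc o < m
    1+o<m = ≤-<-trans (≤-trans (s≤s (m≤n+m o (toℕ i))) (≤-reflexive 1+i+o≡j)) (toℕ<n j)

  mod-window-injective : ∀ z → Injective _≡_ _≡_ (λ (i : Fin m) → (toℕ i + z) mod m)
  mod-window-injective z {i} {j} e with <-cmp (toℕ i) (toℕ j)
  ... | tri< i<j _ _ = contradiction e (mod-window-distinct z i<j)
  ... | tri≈ _ i≡j _ = toℕ-injective i≡j
  ... | tri> _ _ j<i = contradiction (sym e) (mod-window-distinct z j<i)

-- The torus C_m □ C_n

module Torus (m n : ℕ) .{{_ : NonZero m}} .{{_ : NonZero n}} (3≤m : 3 ≤ m) (3≤n : 3 ≤ n) where

  T : Graph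
  T = Cycle m □ Cycle n

  -- The covering of the torus by ℕ × ℕ; vertices are addressed as pt (1 + x) (1 + y) so that all
  -- their neighbours are again of the form pt x′ y′.
  pt : ℕ → ℕ → V T
  pt x y = (x mod m , y mod n)

  east : ∀ x y → Adj T (pt x y) (pt (suc x) y)
  east x y = inj₂ (refl , CycAdj-mod m x)

  west : ∀ x y → Adj T (pt (suc x) y) (pt x y)
  west x y = inj₂ (refl , CycAdj-sym (CycAdj-mod m x))

  north : ∀ x y → Adj T (pt x y) (pt x (suc y))
  north x y = inj₁ (refl , CycAdj-mod n y)

  south : ∀ x y → Adj T (pt x (suc y)) (pt x y)
  south x y = inj₁ (refl , CycAdj-sym (CycAdj-mod n y))

  irreflexive : ∀ {v} → ¬ Adj T v v
  irreflexive (inj₁ (_ , adj)) = CycAdj-irrefl (≤-trans (s≤s (s≤s z≤n)) 3≤n) adj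
  irreflexive (inj₂ (_ , adj)) = CycAdj-irrefl (≤-trans (s≤s (s≤s z≤n)) 3≤m) adj

  adjacent⇒≢ : ∀ {v w} → Adj T v w → v ≢ w
  adjacent⇒≢ adj refl = irreflexive adj

  neighbours : ℕ → ℕ → Vec (V T) 4
  neighbours x y = pt x (1 + y) ∷ pt (2 + x) (1 + y) ∷ pt (1 + x) y ∷ pt (1 + x) (2 + y) ∷ []

  neighbours-adjacent : ∀ x y → All (Adj T (pt (1 + x) (1 + y))) (neighbours x y)
  neighbours-adjacent x y = west x (1 + y) ∷ east (1 + x) (1 + y) ∷ south (1 + x) y ∷ north (1 + x) (1 + y) ∷ []

  neighbours-unique : ∀ x y → Unique (neighbours x y)
  neighbours-unique x y =
    (apartˣ (mod-distinct m x 1 3≤m) ∷ apartˣ (mod-distinct m x 0 2≤m) ∷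
      apartˣ (mod-distinct m x 0 2≤m) ∷ []) ∷
    (apartˣ (mod-distinct m (1 + x) 0 2≤m ∘ sym) ∷ apartˣ (mod-distinct m (1 + x) 0 2≤m ∘ sym) ∷ []) ∷
    (apartʸ (mod-distinct n y 1 3≤n) ∷ []) ∷ [] ∷ []
    where
    2≤m : 2 ≤ m
    2≤m = ≤-trans (s≤s (s≤s z≤n)) 3≤m
    apartˣ : ∀ {x x′ y y′} → x mod m ≢ x′ mod m → pt x y ≢ pt x′ y′
    apartˣ ne e = ne (cong proj₁ e)
    apartʸ : ∀ {x x′ y y′} → y mod n ≢ y′ mod n → pt x y ≢ pt x′ y′
    apartʸ ne e = ne (cong proj₂ e)

  five≤colours : ∀ {k} {c : Incidence T → Fin k} → IsIncidenceColoring T k c → 5 ≤ k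
  five≤colours valid = IncidenceColouring.degree<colours valid (neighbours-unique 0 0) (neighbours-adjacent 0 0)
    (west 1 1) (adjacent⇒≢ (west 1 1))

  module FiveColouring {c : Incidence T → Fin 5} (valid : IsIncidenceColoring T 5 c) where

    inColour : ℕ → ℕ → Fin 5
    inColour x y = c (pt (2 + x) (1 + y) , pt (1 + x) (1 + y) , west (1 + x) (1 + y))

    inColour-agrees : ∀ x y {v w} → v ≡ pt (1 + x) (1 + y) → (p : Adj T w v) → c (w , v , p) ≡ inColour x y
    inColour-agrees x y refl p = in-colours-agree valid (neighbours-unique x y) (neighbours-adjacent x y)
      p (west (1 + x) (1 + y)) (adjacent⇒≢ p) (adjacent⇒≢ (west (1 + x) (1 + y)))

    inColour-rainbow : Rainbow inColour
    inColour-rainbow x y = subst Unique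
      (cong₂ _∷_ refl (cong₂ _∷_ refl (cong₂ _∷_ (agrees (2 + x) (1 + y) (east (2 + x) (2 + y)))
        (cong₂ _∷_ (agrees (1 + x) y (south (2 + x) (1 + y)))
          (cong₂ _∷_ (agrees (1 + x) (2 + y) (north (2 + x) (2 + y))) refl)))))
      (IncidenceColouring.in∷outColours-unique valid (neighbours-unique (1 + x) (1 + y))
        (neighbours-adjacent (1 + x) (1 + y)) (west (2 + x) (2 + y)) (adjacent⇒≢ (west (2 + x) (2 + y))))
      where
      agrees : ∀ x y {w} (p : Adj T w (pt (1 + x) (1 + y))) → c (w , pt (1 + x) (1 + y) , p) ≡ inColour x y
      agrees x y = inColour-agrees x y refl

    five∣m : 5 ∣ m
    five∣m = rainbow-row-period⇒5∣ {inColour} m inColour-rainbow λ x y →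
      inColour-agrees x y (cong (_, _) (mod-period m (1 + x))) (west (1 + x + m) (1 + y))

    five∣n : 5 ∣ n
    five∣n = rainbow-row-period⇒5∣ {λ x y → inColour y x} n (rainbow-transpose {a = inColour} inColour-rainbow)
      λ x y →
      inColour-agrees y x (cong (_ ,_) (mod-period n (1 + x))) (west (1 + y) (1 + x + n))

  module LinearColouring (5∣m : 5 ∣ m) (5∣n : 5 ∣ n) where

    χ : V T → Fin 5
    χ (i , j) = (toℕ i + toℕ j + toℕ j) mod 5

    χ-pt : ∀ x y → χ (pt x y) ≡ (x + y + y) mod 5
    χ-pt x y = toℕ-injective (begin
      toℕ (χ (pt x y))
        ≡⟨ toℕ-mod 5 (toℕ (x mod m) + toℕ (y mod n) + toℕ (y mod n)) ⟩
      (toℕ (x mod m) + toℕ (y mod n) + toℕ (y mod n)) % 5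
        ≡⟨ cong₂ (λ s t → (s + t + t) % 5) (toℕ-mod m x) (toℕ-mod n y) ⟩
      (x % m + y % n + y % n) % 5
        ≡⟨ %-cong-+ (x % m + y % n) (x + y) (y % n) y (%-cong-+ (x % m) x (y % n) y x%m≡x y%n≡y) y%n≡y ⟩
      (x + y + y) % 5
        ≡⟨ sym (toℕ-mod 5 (x + y + y)) ⟩
      toℕ ((x + y + y) mod 5) ∎)
      where
      open ≡-Reasoning
      x%m≡x : x % m % 5 ≡ x % 5
      x%m≡x = m∣n⇒o%n%m≡o%m 5 m x 5∣m
      y%n≡y : y % n % 5 ≡ y % 5
      y%n≡y = m∣n⇒o%n%m≡o%m 5 n y 5∣n

    closedNeighbourhood : ℕ → ℕ → Vec (V T) 5
    closedNeighbourhood x y =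
      pt (1 + x) y ∷ pt x (1 + y) ∷ pt (1 + x) (1 + y) ∷ pt (2 + x) (1 + y) ∷ pt (1 + x) (2 + y) ∷ []

    χ-closedNeighbourhood : ∀ x y i → χ (lookup (closedNeighbourhood x y) i) ≡ (toℕ i + suc (x + y + y)) mod 5
    χ-closedNeighbourhood x y zero                   = χ-pt (1 + x) y
    χ-closedNeighbourhood x y (suc zero)             =
      trans (χ-pt x (1 + y)) (cong (_mod 5) (m+[1+n]+[1+n]≡2+[m+n+n] x y))
    χ-closedNeighbourhood x y (suc (suc zero))       =
      trans (χ-pt (1 + x) (1 + y)) (cong (_mod 5) (m+[1+n]+[1+n]≡2+[m+n+n] (1 + x) y))
    χ-closedNeighbourhood x y (suc (suc (suc zero))) =
      trans (χ-pt (2 + x) (1 + y)) (cong (_mod 5) (m+[1+n]+[1+n]≡2+[m+n+n] (2 + x) y))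
    χ-closedNeighbourhood x y (suc (suc (suc (suc zero)))) =
      trans (χ-pt (1 + x) (2 + y)) (cong (_mod 5) (trans (m+[1+n]+[1+n]≡2+[m+n+n] (1 + x) (1 + y))
                                                        (cong (2 +_) (m+[1+n]+[1+n]≡2+[m+n+n] (1 + x) y))))

    closedNeighbourhood-injective : ∀ x y → Injective _≡_ _≡_ (χ ∘ lookup (closedNeighbourhood x y))
    closedNeighbourhood-injective x y {i} {j} e = mod-window-injective 5 (suc (x + y + y))
      (trans (sym (χ-closedNeighbourhood x y i)) (trans e (χ-closedNeighbourhood x y j)))

    closedNeighbourhood-covers : ∀ x y {w} → Adj T (pt (1 + x) (1 + y)) w →
      Σ (Fin 5) λ i → i ≢ # 2 × lookup (closedNeighbourhood x y) i ≡ w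
    closedNeighbourhood-covers x y (inj₁ (refl , adj)) with CycAdj-mod-neighbours n y adj
    ... | inj₁ refl = # 0 , (λ ()) , refl
    ... | inj₂ refl = # 4 , (λ ()) , refl
    closedNeighbourhood-covers x y (inj₂ (refl , adj)) with CycAdj-mod-neighbours m x adj
    ... | inj₁ refl = # 1 , (λ ()) , refl
    ... | inj₂ refl = # 3 , (λ ()) , refl

    vertex-as-pt : ∀ v → Σ ℕ λ x → Σ ℕ λ y → pt (1 + x) (1 + y) ≡ v
    vertex-as-pt (i , j) with x , eˣ ← suc-mod-surjective m i | y , eʸ ← suc-mod-surjective n j =
      x , y , cong₂ _,_ eˣ eʸ

    χ-adjacent-distinct : ∀ {v w} → Adj T v w → χ v ≢ χ w
    χ-adjacent-distinct {v} p e with vertex-as-pt v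
    ... | x , y , refl with closedNeighbourhood-covers x y p
    ... | i , i≢2 , refl = i≢2 (sym (closedNeighbourhood-injective x y {# 2} {i} e))

    χ-neighbours-injective : ∀ {v w w′} → Adj T v w → Adj T v w′ → χ w ≡ χ w′ → w ≡ w′
    χ-neighbours-injective {v} p p′ e with vertex-as-pt v
    ... | x , y , refl with closedNeighbourhood-covers x y p | closedNeighbourhood-covers x y p′
    ... | i , _ , refl | i′ , _ , refl =
      cong (lookup (closedNeighbourhood x y)) (closedNeighbourhood-injective x y {i} {i′} e)

    linear-colouring : IsIncidenceColoring T 5 (λ (_ , w , _) → χ w)
    linear-colouring = head-colouring χ irreflexive χ-adjacent-distinct χ-neighbours-injective

corollary1 : (m n : ℕ) → 3 ≤ m → 3 ≤ n →
    ((k : ℕ) → IncChromaticNumber (Cycle m □ Cycle n) k → 5 ≤ k)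
    × (IncChromaticNumber (Cycle m □ Cycle n) 5 ⇔ (5 ∣ m × 5 ∣ n))
corollary1 zero      _         ()  _
corollary1 (suc _)   zero      _   ()
corollary1 m@(suc _) n@(suc _) 3≤m 3≤n =
  (λ _ ((_ , valid) , _) → five≤colours valid) ,
  mk⇔ (λ ((_ , valid) , _) → FiveColouring.five∣m valid , FiveColouring.five∣n valid)
      (λ (5∣m , 5∣n) → (_ , LinearColouring.linear-colouring 5∣m 5∣n) ,
                       λ _ (_ , valid) → five≤colours valid)
  where open Torus m n 3≤m 3≤n
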